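{- Let $a,b$ be integers with $a\neq 0$ and $\gcd(a,b)=1$, let $k$ be a positive integer, let $c_1,e_1\in\mathbb{Q}\setminus\{0\}$ and $c_0,e_0\in\mathbb{Q}$, and let $q\geq 3$ be an integer. Then, as polynomials in $x$, $$S_{a,b}^k(c_1x+c_0)\neq e_1x^q+e_0.$$
   Context: For integers $a\neq 0$, $b$ with $\gcd(a,b)=1$ and a positive integer $k$, define the polynomial $$S_{a,b}^k(x):=\frac{a^k}{k+1}\left(B_{k+1}\left(x+\frac{b}{a}\right)-B_{k+1}\left(\frac{b}{a}\right)\right),$$ where $B_n(x)$ is the $n$-th Bernoulli polynomial, defined by $\frac{t e^{tx}}{e^t-1}=\sum_{n\geq 0}B_n(x)\frac{t^n}{n!}$. -}

module Defs where

open import Data.Nat as ℕ using (ℕ; zero; suc)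
open import Data.Nat.Combinatorics using (_C_)
open import Data.Integer as ℤ using (ℤ; +_; -[1+_]; 0ℤ)
open import Data.Rational as ℚ using (ℚ; 0ℚ; 1ℚ; _+_; _*_; -_; _/_)
open import Data.List using (List; []; _∷_; _++_; [_]; map; replicate; foldr)
open import Relation.Binary.PropositionalEquality using (_≡_; _≢_)
open import Relation.Nullary using (contradiction)

-- Polynomials over ℚ in one variable x, as coefficient lists
-- (the i-th entry is the coefficient of x^i).
Poly : Set
Poly = List ℚ

coeff : Poly → ℕ → ℚ
coeff []      _       = 0ℚ
coeff (c ∷ p) zero    = c
coeff (c ∷ p) (suc i) = coeff p i

infix 4 _≈ₚ_
_≈ₚ_ : Poly → Poly → Set
p ≈ₚ q = ∀ i → coeff p i ≡ coeff q i

constP : ℚ → Poly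
constP c = [ c ]

X : Poly
X = 0ℚ ∷ 1ℚ ∷ []

monomial : ℕ → ℚ → Poly
monomial n e = replicate n 0ℚ ++ [ e ]

addP : Poly → Poly → Poly
addP []      q       = q
addP (c ∷ p) []      = c ∷ p
addP (c ∷ p) (d ∷ q) = (c + d) ∷ addP p q

scaleP : ℚ → Poly → Poly
scaleP c p = map (c *_) p

subP : Poly → Poly → Poly
subP p q = addP p (scaleP (- 1ℚ) q)

mulP : Poly → Poly → Poly
mulP []      q = []
mulP (c ∷ p) q = addP (scaleP c q) (0ℚ ∷ mulP p q)

evalP : Poly → ℚ → ℚ
evalP p t = foldr (λ c acc → c + t * acc) 0ℚ p

compP : Poly → Poly → Poly
compP p r = foldr (λ c acc → addP (constP c) (mulP r acc)) [] p

ℕtoℚ : ℕ → ℚ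
ℕtoℚ n = (+ n) / 1

-- Comparing coefficients of t^(n+1) in
--   t e^{tx} = (e^t - 1) Σ_n B_n(x) t^n / n!
-- gives  Σ_{j=0}^{n} C(n+1,j) B_j(x) = (n+1) x^n, i.e. B_0(x) = 1 and
--   B_n(x) = x^n - (1/(n+1)) Σ_{j<n} C(n+1,j) B_j(x).
-- weightedSum m j [B_j, B_{j+1}, ...] = Σ_i C(m, j+i) B_{j+i}
weightedSum : ℕ → ℕ → List Poly → Poly
weightedSum m j []       = []
weightedSum m j (b ∷ bs) = addP (scaleP (ℕtoℚ (m C j)) b) (weightedSum m (suc j) bs)

bernoulliPolys : ℕ → List Poly
bernoulliPolys zero    = [ constP 1ℚ ]
bernoulliPolys (suc n) =
  bs ++ [ subP (monomial (suc n) 1ℚ)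
               (scaleP (+ 1 / suc (suc n)) (weightedSum (suc (suc n)) 0 bs)) ]
  where bs = bernoulliPolys n

nthPoly : List Poly → ℕ → Poly
nthPoly []       _       = []
nthPoly (p ∷ ps) zero    = p
nthPoly (p ∷ ps) (suc i) = nthPoly ps i

bernoulliPoly : ℕ → Poly
bernoulliPoly n = nthPoly (bernoulliPolys n) n

divℤ : ℤ → (a : ℤ) → a ≢ 0ℤ → ℚ
divℤ b (+ zero)    a≢0 = contradiction _≡_.refl a≢0
divℤ b (+ suc n)   _   = b / suc n
divℤ b -[1+ n ]    _   = (ℤ.- b) / suc n

S : (a b : ℤ) → a ≢ 0ℤ → ℕ → Poly
S a b a≢0 k =
  scaleP ((a ℤ.^ k) / 1 * (+ 1 / suc k))
         (subP (compP (bernoulliPoly (suc k)) (addP X (constP r)))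
               (constP (evalP (bernoulliPoly (suc k)) r)))
  where r = divℤ b a a≢0

module Submission where

-- Put m = k + 1.  Away from the constant term, S^k_{a,b}(x) is
-- a^k/(k+1) · B_m(x + b/a), and B_m = x^m + β x^{m-1} + γ x^{m-2} + …
-- with β = -m/2 and γ = m(m-1)/12.  Hence S^k_{a,b}(c₁ x + c₀) has degree
-- exactly m, which disposes of q ≠ m.  For q = m ≥ 3 the coefficients of
-- x^{m-1} and x^{m-2} on the right vanish.  On the left, with the total
-- shift w = b/a + c₀ and up to nonzero factors, they are β + m w and
-- γ + (m-1) w β + C(m,2) w²; the first forces w = 1/2, and then the second
-- equals -m(m-1)/24 ≠ 0.

open import Defs
open import Data.Nat as ℕ using (ℕ; zero; suc; _≤_; _<_; _≥_; z≤n; s≤s)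
import Data.Nat.Properties as NP
open import Data.Nat.Combinatorics using (_C_; nC1≡n; nCk+nC[k+1]≡[n+1]C[k+1]; nCk≡nC[n∸k])
open import Data.Integer as ℤ using (ℤ; +_; 0ℤ)
import Data.Integer.Properties as ZP
import Data.Integer.Solver as ZSolver
open import Data.Integer.GCD using (gcd)
open import Data.Rational as ℚ using (ℚ; 0ℚ; 1ℚ; _+_; _*_; -_; _-_; _/_; toℚᵘ)
import Data.Rational.Properties as QP
import Data.Rational.Unnormalised as U
import Data.Rational.Unnormalised.Properties as UP
open import Data.Rational.Solver using (module +-*-Solver)
open import Data.List using ([]; _∷_; _++_; [_]; length)
open import Data.List.Properties using (length-++)
open import Data.Empty using (⊥; ⊥-elim)
open import Relation.Binary.Definitions using (tri<; tri≈; tri>)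
open import Relation.Binary.PropositionalEquality using (_≡_; _≢_; refl; sym; trans; cong; cong₂; module ≡-Reasoning)
open import Relation.Nullary using (¬_)

open +-*-Solver using (solve; _:=_; _:+_; _:*_; _:-_; :-_; con)
module ZS = ZSolver.+-*-Solver

-- ℕtoℚ is computed through the unnormalised rationals, where its
-- defining identities become integer identities.
toℚᵘ-ℕtoℚ : ∀ n → toℚᵘ (ℕtoℚ n) U.≃ U.mkℚᵘ (+ n) 0
toℚᵘ-ℕtoℚ n = QP.toℚᵘ-fromℚᵘ (U.mkℚᵘ (+ n) 0)

ℕtoℚ-suc : ∀ n → ℕtoℚ (suc n) ≡ 1ℚ + ℕtoℚ n
ℕtoℚ-suc n = QP.toℚᵘ-injective (begin
    toℚᵘ (ℕtoℚ (suc n))                ≈⟨ toℚᵘ-ℕtoℚ (suc n) ⟩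
    U.mkℚᵘ (+ suc n) 0                  ≈⟨ U.*≡* (ZS.solve 1 (λ x → (ZS.con (+ 1) ZS.:+ x) ZS.:* ZS.con (+ 1)
           ZS.:= (ZS.con (+ 1) ZS.:* ZS.con (+ 1) ZS.:+ x ZS.:* ZS.con (+ 1)) ZS.:* ZS.con (+ 1)) refl (+ n)) ⟩
    U.mkℚᵘ (+ 1) 0 U.+ U.mkℚᵘ (+ n) 0   ≈⟨ UP.+-cong (UP.≃-sym (toℚᵘ-ℕtoℚ 1)) (UP.≃-sym (toℚᵘ-ℕtoℚ n)) ⟩
    toℚᵘ 1ℚ U.+ toℚᵘ (ℕtoℚ n)           ≈⟨ UP.≃-sym (QP.toℚᵘ-homo-+ 1ℚ (ℕtoℚ n)) ⟩
    toℚᵘ (1ℚ + ℕtoℚ n)                  ∎)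
  where open UP.≃-Reasoning

ℕtoℚ-suc-inverse : ∀ n → ℕtoℚ (suc n) * (+ 1 / suc n) ≡ 1ℚ
ℕtoℚ-suc-inverse n = QP.toℚᵘ-injective (begin
    toℚᵘ (ℕtoℚ (suc n) * (+ 1 / suc n))          ≈⟨ QP.toℚᵘ-homo-* (ℕtoℚ (suc n)) (+ 1 / suc n) ⟩
    toℚᵘ (ℕtoℚ (suc n)) U.* toℚᵘ (+ 1 / suc n)   ≈⟨ UP.*-cong (toℚᵘ-ℕtoℚ (suc n)) (QP.toℚᵘ-fromℚᵘ (U.mkℚᵘ (+ 1) n)) ⟩
    U.mkℚᵘ (+ suc n) 0 U.* U.mkℚᵘ (+ 1) n         ≈⟨ U.*≡* (ZS.solve 1 (λ x → ((ZS.con (+ 1) ZS.:+ x) ZS.:* ZS.con (+ 1)) ZS.:* ZS.con (+ 1)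
           ZS.:= ZS.con (+ 1) ZS.:* (ZS.con (+ 1) ZS.:* (ZS.con (+ 1) ZS.:+ x))) refl (+ n)) ⟩
    toℚᵘ 1ℚ                                       ∎)
  where open UP.≃-Reasoning

ℕtoℚ-+ : ∀ m n → ℕtoℚ (m ℕ.+ n) ≡ ℕtoℚ m + ℕtoℚ n
ℕtoℚ-+ zero    n = sym (QP.+-identityˡ (ℕtoℚ n))
ℕtoℚ-+ (suc m) n = begin
  ℕtoℚ (suc (m ℕ.+ n))        ≡⟨ ℕtoℚ-suc (m ℕ.+ n) ⟩
  1ℚ + ℕtoℚ (m ℕ.+ n)         ≡⟨ cong (λ z → 1ℚ + z) (ℕtoℚ-+ m n) ⟩
  1ℚ + (ℕtoℚ m + ℕtoℚ n)      ≡⟨ sym (QP.+-assoc 1ℚ (ℕtoℚ m) (ℕtoℚ n)) ⟩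
  (1ℚ + ℕtoℚ m) + ℕtoℚ n      ≡⟨ cong (_+ ℕtoℚ n) (sym (ℕtoℚ-suc m)) ⟩
  ℕtoℚ (suc m) + ℕtoℚ n       ∎
  where open ≡-Reasoning

cancel-nonzero : ∀ x y → x * y ≡ 0ℚ → x ≢ 0ℚ → y ≡ 0ℚ
cancel-nonzero x y xy≡0 x≢0 = begin
  y                    ≡⟨ sym (QP.*-identityˡ y) ⟩
  1ℚ * y               ≡⟨ cong (_* y) (sym (QP.*-inverseˡ x)) ⟩
  (ℚ.1/ x) * x * y     ≡⟨ QP.*-assoc (ℚ.1/ x) x y ⟩
  (ℚ.1/ x) * (x * y)   ≡⟨ cong (ℚ.1/ x *_) xy≡0 ⟩
  (ℚ.1/ x) * 0ℚ        ≡⟨ QP.*-zeroʳ (ℚ.1/ x) ⟩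
  0ℚ                   ∎
  where
  open ≡-Reasoning
  instance _ = ℚ.≢-nonZero x≢0

*-nonzero : ∀ x y → x ≢ 0ℚ → y ≢ 0ℚ → x * y ≢ 0ℚ
*-nonzero x y x≢0 y≢0 xy≡0 = y≢0 (cancel-nonzero x y xy≡0 x≢0)

pow : ℚ → ℕ → ℚ
pow x zero    = 1ℚ
pow x (suc n) = x * pow x n

pow-nonzero : ∀ x n → x ≢ 0ℚ → pow x n ≢ 0ℚ
pow-nonzero x zero    x≢0 ()
pow-nonzero x (suc n) x≢0 = *-nonzero x (pow x n) x≢0 (pow-nonzero x n x≢0)

pow-one : ∀ n → pow 1ℚ n ≡ 1ℚ
pow-one zero    = refl
pow-one (suc n) = trans (QP.*-identityˡ (pow 1ℚ n)) (pow-one n)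

ℕtoℚ-suc-nonzero : ∀ n → ℕtoℚ (suc n) ≢ 0ℚ
ℕtoℚ-suc-nonzero n n+1≡0 = QP.1≢0 (begin
  1ℚ                               ≡⟨ sym (ℕtoℚ-suc-inverse n) ⟩
  ℕtoℚ (suc n) * (+ 1 / suc n)     ≡⟨ cong (_* (+ 1 / suc n)) n+1≡0 ⟩
  0ℚ * (+ 1 / suc n)               ≡⟨ QP.*-zeroˡ (+ 1 / suc n) ⟩
  0ℚ                               ∎)
  where open ≡-Reasoning

reciprocal-nonzero : ∀ n → (+ 1 / suc n) ≢ 0ℚ
reciprocal-nonzero n 1/n+1≡0 = QP.1≢0 (begin
  1ℚ                               ≡⟨ sym (ℕtoℚ-suc-inverse n) ⟩
  ℕtoℚ (suc n) * (+ 1 / suc n)     ≡⟨ cong (ℕtoℚ (suc n) *_) 1/n+1≡0 ⟩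
  ℕtoℚ (suc n) * 0ℚ                ≡⟨ QP.*-zeroʳ (ℕtoℚ (suc n)) ⟩
  0ℚ                               ∎)
  where open ≡-Reasoning

ℤtoℚ-nonzero : ∀ i → i ≢ 0ℤ → (i / 1) ≢ 0ℚ
ℤtoℚ-nonzero i i≢0 i/1≡0 = i≢0 (begin
  i                              ≡⟨ sym (QP.↥-/ i 1) ⟩
  ℚ.↥ (i / 1) ℤ.* gcd i (+ 1)     ≡⟨ cong (ℤ._* gcd i (+ 1)) (QP.p≡0⇒↥p≡0 (i / 1) i/1≡0) ⟩
  0ℤ ℤ.* gcd i (+ 1)              ≡⟨ ZP.*-zeroˡ (gcd i (+ 1)) ⟩
  0ℤ                             ∎)
  where open ≡-Reasoning

pascal : ∀ n k → ℕtoℚ (suc n C suc k) ≡ ℕtoℚ (n C k) + ℕtoℚ (n C suc k)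
pascal n k = trans (cong ℕtoℚ (sym (nCk+nC[k+1]≡[n+1]C[k+1] n k))) (ℕtoℚ-+ (n C k) (n C suc k))

choose2-suc : ∀ n → ℕtoℚ (suc n C 2) ≡ ℕtoℚ n + ℕtoℚ (n C 2)
choose2-suc n = trans (pascal n 1) (cong (λ z → ℕtoℚ z + ℕtoℚ (n C 2)) (nC1≡n n))

choose2 : ∀ n → ℕtoℚ 2 * ℕtoℚ (suc n C 2) ≡ ℕtoℚ (suc n) * ℕtoℚ n
choose2 zero    = refl
choose2 (suc n) = begin
  ℕtoℚ 2 * ℕtoℚ (suc (suc n) C 2)                   ≡⟨ cong (ℕtoℚ 2 *_) (choose2-suc (suc n)) ⟩
  ℕtoℚ 2 * (ℕtoℚ (suc n) + ℕtoℚ (suc n C 2))        ≡⟨ solve 2 (λ m c → con (ℕtoℚ 2) :* (m :+ c) := con (ℕtoℚ 2) :* m :+ con (ℕtoℚ 2) :* c)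
                                                          refl (ℕtoℚ (suc n)) (ℕtoℚ (suc n C 2)) ⟩
  ℕtoℚ 2 * ℕtoℚ (suc n) + ℕtoℚ 2 * ℕtoℚ (suc n C 2) ≡⟨ cong (λ z → ℕtoℚ 2 * ℕtoℚ (suc n) + z) (choose2 n) ⟩
  ℕtoℚ 2 * ℕtoℚ (suc n) + ℕtoℚ (suc n) * ℕtoℚ n     ≡⟨ cong (λ z → ℕtoℚ 2 * z + z * ℕtoℚ n) (ℕtoℚ-+ 1 n) ⟩
  ℕtoℚ 2 * (ℕtoℚ 1 + x) + (ℕtoℚ 1 + x) * x          ≡⟨ solve 1 (λ x → con (ℕtoℚ 2) :* (con (ℕtoℚ 1) :+ x) :+ (con (ℕtoℚ 1) :+ x) :* x
                                                                 := (con (ℕtoℚ 2) :+ x) :* (con (ℕtoℚ 1) :+ x)) refl x ⟩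
  (ℕtoℚ 2 + x) * (ℕtoℚ 1 + x)                       ≡⟨ sym (cong₂ _*_ (ℕtoℚ-+ 2 n) (ℕtoℚ-+ 1 n)) ⟩
  ℕtoℚ (suc (suc n)) * ℕtoℚ (suc n)                 ∎
  where
  open ≡-Reasoning
  x : ℚ
  x = ℕtoℚ n

choose3 : ∀ n → ℕtoℚ 6 * ℕtoℚ (suc (suc n) C 3) ≡ ℕtoℚ (suc (suc n)) * ℕtoℚ (suc n) * ℕtoℚ n
choose3 zero    = refl
choose3 (suc n) = begin
  ℕtoℚ 6 * ℕtoℚ (suc (suc (suc n)) C 3)               ≡⟨ cong (ℕtoℚ 6 *_) (pascal (suc (suc n)) 2) ⟩
  ℕtoℚ 6 * (ℕtoℚ (suc (suc n) C 2) + ℕtoℚ (suc (suc n) C 3))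
    ≡⟨ solve 2 (λ a b → con (ℕtoℚ 6) :* (a :+ b) := con (ℕtoℚ 3) :* (con (ℕtoℚ 2) :* a) :+ con (ℕtoℚ 6) :* b)
         refl (ℕtoℚ (suc (suc n) C 2)) (ℕtoℚ (suc (suc n) C 3)) ⟩
  ℕtoℚ 3 * (ℕtoℚ 2 * ℕtoℚ (suc (suc n) C 2)) + ℕtoℚ 6 * ℕtoℚ (suc (suc n) C 3)
    ≡⟨ cong₂ (λ y z → ℕtoℚ 3 * y + z) (choose2 (suc n)) (choose3 n) ⟩
  ℕtoℚ 3 * (ℕtoℚ (suc (suc n)) * ℕtoℚ (suc n)) + ℕtoℚ (suc (suc n)) * ℕtoℚ (suc n) * x
    ≡⟨ cong₂ (λ a b → ℕtoℚ 3 * (a * b) + a * b * x) (ℕtoℚ-+ 2 n) (ℕtoℚ-+ 1 n) ⟩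
  ℕtoℚ 3 * ((ℕtoℚ 2 + x) * (ℕtoℚ 1 + x)) + (ℕtoℚ 2 + x) * (ℕtoℚ 1 + x) * x
    ≡⟨ solve 1 (λ x → con (ℕtoℚ 3) :* ((con (ℕtoℚ 2) :+ x) :* (con (ℕtoℚ 1) :+ x)) :+ (con (ℕtoℚ 2) :+ x) :* (con (ℕtoℚ 1) :+ x) :* x
                      := (con (ℕtoℚ 3) :+ x) :* (con (ℕtoℚ 2) :+ x) :* (con (ℕtoℚ 1) :+ x)) refl x ⟩
  (ℕtoℚ 3 + x) * (ℕtoℚ 2 + x) * (ℕtoℚ 1 + x)
    ≡⟨ sym (cong₂ _*_ (cong₂ _*_ (ℕtoℚ-+ 3 n) (ℕtoℚ-+ 2 n)) (ℕtoℚ-+ 1 n)) ⟩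
  ℕtoℚ (suc (suc (suc n))) * ℕtoℚ (suc (suc n)) * ℕtoℚ (suc n) ∎
  where
  open ≡-Reasoning
  x : ℚ
  x = ℕtoℚ n

choose-symmetric : ∀ k n → ℕtoℚ ((k ℕ.+ n) C n) ≡ ℕtoℚ ((k ℕ.+ n) C k)
choose-symmetric k n =
  cong ℕtoℚ (trans (nCk≡nC[n∸k] (NP.m≤n+m n k)) (cong ((k ℕ.+ n) C_) (NP.m+n∸n≡m k n)))

coeff-addP : ∀ p q i → coeff (addP p q) i ≡ coeff p i + coeff q i
coeff-addP []      q       i       = sym (QP.+-identityˡ (coeff q i))
coeff-addP (c ∷ p) []      i       = sym (QP.+-identityʳ (coeff (c ∷ p) i))
coeff-addP (c ∷ p) (d ∷ q) zero    = refl
coeff-addP (c ∷ p) (d ∷ q) (suc i) = coeff-addP p q i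

coeff-scaleP : ∀ c p i → coeff (scaleP c p) i ≡ c * coeff p i
coeff-scaleP c []      i       = sym (QP.*-zeroʳ c)
coeff-scaleP c (x ∷ p) zero    = refl
coeff-scaleP c (x ∷ p) (suc i) = coeff-scaleP c p i

coeff-subP : ∀ p q i → coeff (subP p q) i ≡ coeff p i - coeff q i
coeff-subP p q i = begin
  coeff (subP p q) i                      ≡⟨ coeff-addP p (scaleP (- 1ℚ) q) i ⟩
  coeff p i + coeff (scaleP (- 1ℚ) q) i   ≡⟨ cong (λ z → coeff p i + z) (coeff-scaleP (- 1ℚ) q i) ⟩
  coeff p i + (- 1ℚ) * coeff q i          ≡⟨ solve 2 (λ x y → x :+ con (- 1ℚ) :* y := x :- y) refl (coeff p i) (coeff q i) ⟩
  coeff p i - coeff q i                   ∎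
  where open ≡-Reasoning

-- adding a constant (in particular subtracting one, since
-- subP p (constP c) = addP p (constP (- 1ℚ * c))) only affects x⁰
coeff-addP-constP : ∀ p c i → coeff (addP p (constP c)) (suc i) ≡ coeff p (suc i)
coeff-addP-constP p c i = trans (coeff-addP p (constP c) (suc i)) (QP.+-identityʳ (coeff p (suc i)))

coeff-monomial-at : ∀ n e → coeff (monomial n e) n ≡ e
coeff-monomial-at zero    e = refl
coeff-monomial-at (suc n) e = coeff-monomial-at n e

coeff-monomial-off : ∀ n e i → i ≢ n → coeff (monomial n e) i ≡ 0ℚ
coeff-monomial-off zero    e zero    i≢n = ⊥-elim (i≢n refl)
coeff-monomial-off zero    e (suc i) i≢n = refl
coeff-monomial-off (suc n) e zero    i≢n = refl
coeff-monomial-off (suc n) e (suc i) i≢n = coeff-monomial-off n e i (λ i≡n → i≢n (cong suc i≡n))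

DegreeBelow : Poly → ℕ → Set
DegreeBelow p d = ∀ i → d ≤ i → coeff p i ≡ 0ℚ

degree-scaleP : ∀ c p d → DegreeBelow p d → DegreeBelow (scaleP c p) d
degree-scaleP c p d p<d i d≤i = trans (coeff-scaleP c p i) (trans (cong (c *_) (p<d i d≤i)) (QP.*-zeroʳ c))

degree-addP-constP : ∀ p c d → DegreeBelow p (suc d) → DegreeBelow (addP p (constP c)) (suc d)
degree-addP-constP p c d p<d (suc i) d<i = trans (coeff-addP-constP p c i) (p<d (suc i) d<i)

-- Bernoulli polynomials: their three leading coefficients

binomialSum : ℕ → ℕ → Poly
binomialSum m n = weightedSum m 0 (bernoulliPolys n)

κ : ℕ → ℚ
κ n = + 1 / suc (suc n)

length-bernoulliPolys : ∀ n → length (bernoulliPolys n) ≡ suc n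
length-bernoulliPolys zero    = refl
length-bernoulliPolys (suc n) =
  trans (length-++ (bernoulliPolys n)) (trans (NP.+-comm (length (bernoulliPolys n)) 1) (cong suc (length-bernoulliPolys n)))

nthPoly-snoc : ∀ ps p → nthPoly (ps ++ [ p ]) (length ps) ≡ p
nthPoly-snoc []       p = refl
nthPoly-snoc (q ∷ ps) p = nthPoly-snoc ps p

bernoulli-suc : ∀ n →
  bernoulliPoly (suc n) ≡ subP (monomial (suc n) 1ℚ) (scaleP (κ n) (binomialSum (suc (suc n)) n))
bernoulli-suc n = trans (cong (nthPoly (bernoulliPolys n ++ [ B′ ])) (sym (length-bernoulliPolys n)))
                        (nthPoly-snoc (bernoulliPolys n) B′)
  where
  B′ : Poly
  B′ = subP (monomial (suc n) 1ℚ) (scaleP (κ n) (binomialSum (suc (suc n)) n))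

coeff-bernoulli-suc : ∀ n i →
  coeff (bernoulliPoly (suc n)) i ≡ coeff (monomial (suc n) 1ℚ) i - κ n * coeff (binomialSum (suc (suc n)) n) i
coeff-bernoulli-suc n i = begin
  coeff (bernoulliPoly (suc n)) i                                      ≡⟨ cong (λ p → coeff p i) (bernoulli-suc n) ⟩
  coeff (subP (monomial (suc n) 1ℚ) (scaleP (κ n) W)) i                ≡⟨ coeff-subP (monomial (suc n) 1ℚ) (scaleP (κ n) W) i ⟩
  coeff (monomial (suc n) 1ℚ) i - coeff (scaleP (κ n) W) i             ≡⟨ cong (λ z → coeff (monomial (suc n) 1ℚ) i - z) (coeff-scaleP (κ n) W i) ⟩
  coeff (monomial (suc n) 1ℚ) i - κ n * coeff W i                      ∎
  where
  open ≡-Reasoning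
  W : Poly
  W = binomialSum (suc (suc n)) n

coeff-weightedSum-snoc : ∀ m j ps p i →
  coeff (weightedSum m j (ps ++ [ p ])) i ≡ coeff (weightedSum m j ps) i + ℕtoℚ (m C (j ℕ.+ length ps)) * coeff p i
coeff-weightedSum-snoc m j [] p i = begin
  coeff (addP (scaleP (ℕtoℚ (m C j)) p) []) i        ≡⟨ coeff-addP (scaleP (ℕtoℚ (m C j)) p) [] i ⟩
  coeff (scaleP (ℕtoℚ (m C j)) p) i + 0ℚ             ≡⟨ QP.+-comm (coeff (scaleP (ℕtoℚ (m C j)) p) i) 0ℚ ⟩
  0ℚ + coeff (scaleP (ℕtoℚ (m C j)) p) i             ≡⟨ cong (λ k → 0ℚ + coeff (scaleP (ℕtoℚ (m C k)) p) i) (sym (NP.+-identityʳ j)) ⟩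
  0ℚ + coeff (scaleP (ℕtoℚ (m C (j ℕ.+ 0))) p) i     ≡⟨ cong (λ z → 0ℚ + z) (coeff-scaleP (ℕtoℚ (m C (j ℕ.+ 0))) p i) ⟩
  0ℚ + ℕtoℚ (m C (j ℕ.+ 0)) * coeff p i              ∎
  where open ≡-Reasoning
coeff-weightedSum-snoc m j (q ∷ ps) p i = begin
  coeff (addP (scaleP (ℕtoℚ (m C j)) q) (weightedSum m (suc j) (ps ++ [ p ]))) i
    ≡⟨ coeff-addP (scaleP (ℕtoℚ (m C j)) q) _ i ⟩
  a + coeff (weightedSum m (suc j) (ps ++ [ p ])) i
    ≡⟨ cong (λ z → a + z) (coeff-weightedSum-snoc m (suc j) ps p i) ⟩
  a + (coeff (weightedSum m (suc j) ps) i + ℕtoℚ (m C (suc j ℕ.+ length ps)) * coeff p i)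
    ≡⟨ sym (QP.+-assoc a _ _) ⟩
  (a + coeff (weightedSum m (suc j) ps) i) + ℕtoℚ (m C (suc j ℕ.+ length ps)) * coeff p i
    ≡⟨ cong₂ (λ x k → x + ℕtoℚ (m C k) * coeff p i)
         (sym (coeff-addP (scaleP (ℕtoℚ (m C j)) q) (weightedSum m (suc j) ps) i)) (sym (NP.+-suc j (length ps))) ⟩
  coeff (weightedSum m j (q ∷ ps)) i + ℕtoℚ (m C (j ℕ.+ suc (length ps))) * coeff p i
    ∎
  where
  open ≡-Reasoning
  a : ℚ
  a = coeff (scaleP (ℕtoℚ (m C j)) q) i

coeff-binomialSum-zero : ∀ m i → coeff (binomialSum m 0) i ≡ ℕtoℚ (m C 0) * coeff (bernoulliPoly 0) i
coeff-binomialSum-zero m i =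
  trans (coeff-weightedSum-snoc m 0 [] (bernoulliPoly 0) i) (QP.+-identityˡ (ℕtoℚ (m C 0) * coeff (bernoulliPoly 0) i))

coeff-binomialSum-suc : ∀ m n i →
  coeff (binomialSum m (suc n)) i ≡ coeff (binomialSum m n) i + ℕtoℚ (m C suc n) * coeff (bernoulliPoly (suc n)) i
coeff-binomialSum-suc m n i = begin
  coeff (binomialSum m (suc n)) i
    ≡⟨ coeff-weightedSum-snoc m 0 (bernoulliPolys n) B′ i ⟩
  coeff (binomialSum m n) i + ℕtoℚ (m C length (bernoulliPolys n)) * coeff B′ i
    ≡⟨ cong₂ (λ k p → coeff (binomialSum m n) i + ℕtoℚ (m C k) * coeff p i)
         (length-bernoulliPolys n) (sym (bernoulli-suc n)) ⟩
  coeff (binomialSum m n) i + ℕtoℚ (m C suc n) * coeff (bernoulliPoly (suc n)) i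
    ∎
  where
  open ≡-Reasoning
  B′ : Poly
  B′ = subP (monomial (suc n) 1ℚ) (scaleP (κ n) (binomialSum (suc (suc n)) n))

bernoulli-degree : ∀ n → DegreeBelow (bernoulliPoly n) (suc n)
binomialSum-degree : ∀ m n → DegreeBelow (binomialSum m n) (suc n)

bernoulli-degree zero    (suc i) _     = refl
bernoulli-degree (suc n) i       n+1<i = begin
  coeff (bernoulliPoly (suc n)) i                                             ≡⟨ coeff-bernoulli-suc n i ⟩
  coeff (monomial (suc n) 1ℚ) i - κ n * coeff (binomialSum (suc (suc n)) n) i
    ≡⟨ cong₂ (λ x y → x - κ n * y) (coeff-monomial-off (suc n) 1ℚ i (NP.>⇒≢ n+1<i))
                                    (binomialSum-degree (suc (suc n)) n i (NP.<⇒≤ n+1<i)) ⟩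
  0ℚ - κ n * 0ℚ                                                               ≡⟨ solve 1 (λ k → con 0ℚ :- k :* con 0ℚ := con 0ℚ) refl (κ n) ⟩
  0ℚ                                                                          ∎
  where open ≡-Reasoning

binomialSum-degree m zero    i 1≤i = trans (coeff-binomialSum-zero m i)
  (trans (cong (ℕtoℚ (m C 0) *_) (bernoulli-degree 0 i 1≤i)) (QP.*-zeroʳ (ℕtoℚ (m C 0))))
binomialSum-degree m (suc n) i n+1<i = begin
  coeff (binomialSum m (suc n)) i                                                 ≡⟨ coeff-binomialSum-suc m n i ⟩
  coeff (binomialSum m n) i + ℕtoℚ (m C suc n) * coeff (bernoulliPoly (suc n)) i
    ≡⟨ cong₂ (λ x y → x + ℕtoℚ (m C suc n) * y) (binomialSum-degree m n i (NP.<⇒≤ n+1<i)) (bernoulli-degree (suc n) i n+1<i) ⟩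
  0ℚ + ℕtoℚ (m C suc n) * 0ℚ                                                      ≡⟨ solve 1 (λ c → con 0ℚ :+ c :* con 0ℚ := con 0ℚ) refl (ℕtoℚ (m C suc n)) ⟩
  0ℚ                                                                              ∎
  where open ≡-Reasoning

bernoulli-leading : ∀ n → coeff (bernoulliPoly n) n ≡ 1ℚ
bernoulli-leading zero    = refl
bernoulli-leading (suc n) = begin
  coeff (bernoulliPoly (suc n)) (suc n)                                                  ≡⟨ coeff-bernoulli-suc n (suc n) ⟩
  coeff (monomial (suc n) 1ℚ) (suc n) - κ n * coeff (binomialSum (suc (suc n)) n) (suc n)
    ≡⟨ cong₂ (λ x y → x - κ n * y) (coeff-monomial-at (suc n) 1ℚ) (binomialSum-degree (suc (suc n)) n (suc n) NP.≤-refl) ⟩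
  1ℚ - κ n * 0ℚ                                                                          ≡⟨ solve 1 (λ k → con 1ℚ :- k :* con 0ℚ := con 1ℚ) refl (κ n) ⟩
  1ℚ                                                                                     ∎
  where open ≡-Reasoning

binomialSum-leading : ∀ m n → coeff (binomialSum m n) n ≡ ℕtoℚ (m C n)
binomialSum-leading m zero    = trans (coeff-binomialSum-zero m 0) (QP.*-identityʳ (ℕtoℚ (m C 0)))
binomialSum-leading m (suc n) = begin
  coeff (binomialSum m (suc n)) (suc n)                                                      ≡⟨ coeff-binomialSum-suc m n (suc n) ⟩
  coeff (binomialSum m n) (suc n) + ℕtoℚ (m C suc n) * coeff (bernoulliPoly (suc n)) (suc n)
    ≡⟨ cong₂ (λ x y → x + ℕtoℚ (m C suc n) * y) (binomialSum-degree m n (suc n) NP.≤-refl) (bernoulli-leading (suc n)) ⟩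
  0ℚ + ℕtoℚ (m C suc n) * 1ℚ                                                                 ≡⟨ solve 1 (λ c → con 0ℚ :+ c :* con 1ℚ := c) refl (ℕtoℚ (m C suc n)) ⟩
  ℕtoℚ (m C suc n)                                                                           ∎
  where open ≡-Reasoning

-- below the leading term, only the j = n - 1 summand is left:
-- [x^{n-1}] B_{n+1} = -1/(n+2) C(n+2, n)
coeff-bernoulli-second : ∀ n → coeff (bernoulliPoly (suc n)) n ≡ - (κ n * ℕtoℚ (suc (suc n) C n))
coeff-bernoulli-second n = begin
  coeff (bernoulliPoly (suc n)) n                                               ≡⟨ coeff-bernoulli-suc n n ⟩
  coeff (monomial (suc n) 1ℚ) n - κ n * coeff (binomialSum (suc (suc n)) n) n
    ≡⟨ cong₂ (λ x y → x - κ n * y) (coeff-monomial-off (suc n) 1ℚ n (NP.<⇒≢ (NP.n<1+n n))) (binomialSum-leading (suc (suc n)) n) ⟩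
  0ℚ - κ n * ℕtoℚ (suc (suc n) C n)                                             ≡⟨ QP.+-identityˡ _ ⟩
  - (κ n * ℕtoℚ (suc (suc n) C n))                                              ∎
  where open ≡-Reasoning

bernoulli-second : ∀ n → ℕtoℚ 2 * coeff (bernoulliPoly (suc n)) n + ℕtoℚ (suc n) ≡ 0ℚ
bernoulli-second n = begin
  ℕtoℚ 2 * coeff (bernoulliPoly (suc n)) n + M₁       ≡⟨ cong (λ z → ℕtoℚ 2 * z + M₁) (coeff-bernoulli-second n) ⟩
  ℕtoℚ 2 * - (κ n * C₂) + M₁                          ≡⟨ solve 3 (λ k c m → con (ℕtoℚ 2) :* :- (k :* c) :+ m := :- (k :* (con (ℕtoℚ 2) :* c)) :+ m)
                                                            refl (κ n) C₂ M₁ ⟩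
  - (κ n * (ℕtoℚ 2 * C₂)) + M₁                        ≡⟨ cong (λ z → - (κ n * z) + M₁) (trans (cong (ℕtoℚ 2 *_) (choose-symmetric 2 n)) (choose2 (suc n))) ⟩
  - (κ n * (M₂ * M₁)) + M₁                            ≡⟨ solve 3 (λ k a b → :- (k :* (a :* b)) :+ b := b :- (a :* k) :* b) refl (κ n) M₂ M₁ ⟩
  M₁ - (M₂ * κ n) * M₁                                ≡⟨ cong (λ z → M₁ - z * M₁) (ℕtoℚ-suc-inverse (suc n)) ⟩
  M₁ - 1ℚ * M₁                                        ≡⟨ solve 1 (λ m → m :- con 1ℚ :* m := con 0ℚ) refl M₁ ⟩
  0ℚ                                                  ∎
  where
  open ≡-Reasoning
  C₂ : ℚ
  C₂ = ℕtoℚ (suc (suc n) C n)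
  M₂ : ℚ
  M₂ = ℕtoℚ (suc (suc n))
  M₁ : ℚ
  M₁ = ℕtoℚ (suc n)

-- below the two leading terms, the summands j = n and j = n + 1 contribute:
-- [x^n] B_{n+2} = -1/(n+3) (C(n+3, n) + C(n+3, n+1) [x^n] B_{n+1})
coeff-bernoulli-third : ∀ n → coeff (bernoulliPoly (suc (suc n))) n
  ≡ - (κ (suc n) * (ℕtoℚ (suc (suc (suc n)) C n) + ℕtoℚ (suc (suc (suc n)) C suc n) * coeff (bernoulliPoly (suc n)) n))
coeff-bernoulli-third n = begin
  coeff (bernoulliPoly (suc (suc n))) n                                             ≡⟨ coeff-bernoulli-suc (suc n) n ⟩
  coeff (monomial (suc (suc n)) 1ℚ) n - κ (suc n) * coeff (binomialSum m (suc n)) n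
    ≡⟨ cong₂ (λ x y → x - κ (suc n) * y) (coeff-monomial-off (suc (suc n)) 1ℚ n (NP.<⇒≢ (NP.m<n⇒m<1+n (NP.n<1+n n))))
                                          (coeff-binomialSum-suc m n n) ⟩
  0ℚ - κ (suc n) * (coeff (binomialSum m n) n + ℕtoℚ (m C suc n) * b)
    ≡⟨ cong (λ z → 0ℚ - κ (suc n) * (z + ℕtoℚ (m C suc n) * b)) (binomialSum-leading m n) ⟩
  0ℚ - κ (suc n) * (ℕtoℚ (m C n) + ℕtoℚ (m C suc n) * b)                            ≡⟨ QP.+-identityˡ _ ⟩
  - (κ (suc n) * (ℕtoℚ (m C n) + ℕtoℚ (m C suc n) * b))                             ∎
  where
  open ≡-Reasoning
  m : ℕ
  m = suc (suc (suc n))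
  b : ℚ
  b = coeff (bernoulliPoly (suc n)) n

bernoulli-third : ∀ n → ℕtoℚ 12 * coeff (bernoulliPoly (suc (suc n))) n ≡ ℕtoℚ (suc (suc n)) * ℕtoℚ (suc n)
bernoulli-third n = begin
  ℕtoℚ 12 * coeff (bernoulliPoly (suc (suc n))) n          ≡⟨ cong (ℕtoℚ 12 *_) (coeff-bernoulli-third n) ⟩
  ℕtoℚ 12 * - (κ′ * (A + B * b))
    ≡⟨ solve 4 (λ k a c b → con (ℕtoℚ 12) :* :- (k :* (a :+ c :* b))
                            := :- (k :* (con (ℕtoℚ 2) :* (con (ℕtoℚ 6) :* a) :+ con (ℕtoℚ 3) :* ((con (ℕtoℚ 2) :* c) :* (con (ℕtoℚ 2) :* b)))))
         refl κ′ A B b ⟩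
  - (κ′ * (ℕtoℚ 2 * (ℕtoℚ 6 * A) + ℕtoℚ 3 * ((ℕtoℚ 2 * B) * (ℕtoℚ 2 * b))))
    ≡⟨ cong₂ (λ x y → - (κ′ * (ℕtoℚ 2 * x + ℕtoℚ 3 * y))) 6A≡M₃M₂M₁ (cong₂ _*_ 2B≡M₃M₂ 2b≡-M₁) ⟩
  - (κ′ * (ℕtoℚ 2 * (M₃ * M₂ * M₁) + ℕtoℚ 3 * ((M₃ * M₂) * - M₁)))
    ≡⟨ solve 4 (λ k a b c → :- (k :* (con (ℕtoℚ 2) :* (a :* b :* c) :+ con (ℕtoℚ 3) :* ((a :* b) :* :- c))) := (a :* k) :* (b :* c))
         refl κ′ M₃ M₂ M₁ ⟩
  (M₃ * κ′) * (M₂ * M₁)                                   ≡⟨ cong (_* (M₂ * M₁)) (ℕtoℚ-suc-inverse (suc (suc n))) ⟩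
  1ℚ * (M₂ * M₁)                                          ≡⟨ QP.*-identityˡ (M₂ * M₁) ⟩
  M₂ * M₁                                                 ∎
  where
  open ≡-Reasoning
  κ′ : ℚ
  κ′ = κ (suc n)
  A : ℚ
  A  = ℕtoℚ (suc (suc (suc n)) C n)
  B : ℚ
  B  = ℕtoℚ (suc (suc (suc n)) C suc n)
  b : ℚ
  b  = coeff (bernoulliPoly (suc n)) n
  M₃ : ℚ
  M₃ = ℕtoℚ (suc (suc (suc n)))
  M₂ : ℚ
  M₂ = ℕtoℚ (suc (suc n))
  M₁ : ℚ
  M₁ = ℕtoℚ (suc n)
  6A≡M₃M₂M₁ : ℕtoℚ 6 * A ≡ M₃ * M₂ * M₁
  6A≡M₃M₂M₁ = trans (cong (ℕtoℚ 6 *_) (choose-symmetric 3 n)) (choose3 (suc n))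
  2B≡M₃M₂ : ℕtoℚ 2 * B ≡ M₃ * M₂
  2B≡M₃M₂ = trans (cong (ℕtoℚ 2 *_) (choose-symmetric 2 (suc n))) (choose2 (suc (suc n)))
  2b≡-M₁ : ℕtoℚ 2 * b ≡ - M₁
  2b≡-M₁ = begin
    ℕtoℚ 2 * b                 ≡⟨ solve 2 (λ x m → x := (x :+ m) :- m) refl (ℕtoℚ 2 * b) M₁ ⟩
    (ℕtoℚ 2 * b + M₁) - M₁     ≡⟨ cong (_- M₁) (bernoulli-second n) ⟩
    0ℚ - M₁                    ≡⟨ QP.+-identityˡ (- M₁) ⟩
    - M₁                       ∎

-- Substitution of a linear polynomial u + v x

linear : ℚ → ℚ → Poly
linear u v = u ∷ v ∷ []

coeff-zeroP : ∀ i → coeff (0ℚ ∷ []) i ≡ 0ℚ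
coeff-zeroP zero    = refl
coeff-zeroP (suc i) = refl

-- The coefficient of x^d in p(u + v x) when p has degree at most d, d + 1
-- or d + 2, i.e. the top three coefficients of p(u + v x), computed by
-- induction on p from Horner's rule (a + x p(x))(u + v x) = a + (u + v x) · p(u + v x).
module LinearSubstitution (u v : ℚ) where

  compL : Poly → Poly
  compL p = compP p (linear u v)

  compL-cons-zero : ∀ a p → coeff (compL (a ∷ p)) 0 ≡ a + u * coeff (compL p) 0
  compL-cons-zero a p = begin
    coeff (addP (constP a) (mulP (linear u v) q)) 0   ≡⟨ coeff-addP (constP a) (mulP (linear u v) q) 0 ⟩
    a + coeff (mulP (linear u v) q) 0                  ≡⟨ cong (λ z → a + z) (coeff-addP (scaleP u q) _ 0) ⟩
    a + (coeff (scaleP u q) 0 + 0ℚ)                    ≡⟨ cong (λ z → a + (z + 0ℚ)) (coeff-scaleP u q 0) ⟩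
    a + (u * coeff q 0 + 0ℚ)                           ≡⟨ cong (λ z → a + z) (QP.+-identityʳ (u * coeff q 0)) ⟩
    a + u * coeff q 0                                  ∎
    where
    open ≡-Reasoning
    q : Poly
    q = compL p

  compL-cons-suc : ∀ a p i →
    coeff (compL (a ∷ p)) (suc i) ≡ u * coeff (compL p) (suc i) + v * coeff (compL p) i
  compL-cons-suc a p i = begin
    coeff (addP (constP a) (mulP (linear u v) q)) (suc i)        ≡⟨ coeff-addP (constP a) (mulP (linear u v) q) (suc i) ⟩
    0ℚ + coeff (mulP (linear u v) q) (suc i)                      ≡⟨ QP.+-identityˡ _ ⟩
    coeff (mulP (linear u v) q) (suc i)                           ≡⟨ coeff-addP (scaleP u q) _ (suc i) ⟩
    coeff (scaleP u q) (suc i) + coeff (mulP (v ∷ []) q) i        ≡⟨ cong₂ _+_ (coeff-scaleP u q (suc i)) (coeff-addP (scaleP v q) (0ℚ ∷ []) i) ⟩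
    u * coeff q (suc i) + (coeff (scaleP v q) i + coeff (0ℚ ∷ []) i)
      ≡⟨ cong₂ (λ y z → u * coeff q (suc i) + (y + z)) (coeff-scaleP v q i) (coeff-zeroP i) ⟩
    u * coeff q (suc i) + (v * coeff q i + 0ℚ)                    ≡⟨ cong (λ z → u * coeff q (suc i) + z) (QP.+-identityʳ (v * coeff q i)) ⟩
    u * coeff q (suc i) + v * coeff q i                           ∎
    where
    open ≡-Reasoning
    q : Poly
    q = compL p

  degree-tail : ∀ a p d → DegreeBelow (a ∷ p) (suc d) → DegreeBelow p d
  degree-tail a p d ap<d+1 i d≤i = ap<d+1 (suc i) (s≤s d≤i)

  compL-cons-suc-vanishes : ∀ a p i → coeff (compL p) (suc i) ≡ 0ℚ → coeff (compL p) i ≡ 0ℚ →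
    coeff (compL (a ∷ p)) (suc i) ≡ 0ℚ
  compL-cons-suc-vanishes a p i z₁ z₀ = begin
    coeff (compL (a ∷ p)) (suc i)                          ≡⟨ compL-cons-suc a p i ⟩
    u * coeff (compL p) (suc i) + v * coeff (compL p) i    ≡⟨ cong₂ (λ x y → u * x + v * y) z₁ z₀ ⟩
    u * 0ℚ + v * 0ℚ                                        ≡⟨ solve 2 (λ u v → u :* con 0ℚ :+ v :* con 0ℚ := con 0ℚ) refl u v ⟩
    0ℚ                                                     ∎
    where open ≡-Reasoning

  compL-degree : ∀ p d → DegreeBelow p d → DegreeBelow (compL p) d
  compL-degree []      d       p<d i       d≤i       = refl
  compL-degree (a ∷ p) zero    p<0 zero    _         = begin
    coeff (compL (a ∷ p)) 0    ≡⟨ compL-cons-zero a p ⟩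
    a + u * coeff (compL p) 0  ≡⟨ cong₂ (λ x y → x + u * y) (p<0 0 z≤n) (tail<0 0 z≤n) ⟩
    0ℚ + u * 0ℚ                ≡⟨ solve 1 (λ u → con 0ℚ :+ u :* con 0ℚ := con 0ℚ) refl u ⟩
    0ℚ                         ∎
    where
    open ≡-Reasoning
    tail<0 : DegreeBelow (compL p) 0
    tail<0 = compL-degree p 0 (degree-tail a p 0 (λ i _ → p<0 i z≤n))
  compL-degree (a ∷ p) zero    p<0 (suc i) _         =
    compL-cons-suc-vanishes a p i (tail<0 (suc i) z≤n) (tail<0 i z≤n)
    where
    tail<0 : DegreeBelow (compL p) 0
    tail<0 = compL-degree p 0 (degree-tail a p 0 (λ i _ → p<0 i z≤n))
  compL-degree (a ∷ p) (suc d) p<d (suc i) (s≤s d≤i) =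
    compL-cons-suc-vanishes a p i (tail<d (suc i) (NP.m≤n⇒m≤1+n d≤i)) (tail<d i d≤i)
    where
    tail<d : DegreeBelow (compL p) d
    tail<d = compL-degree p d (degree-tail a p d p<d)

  compL-leading : ∀ p d → DegreeBelow p (suc d) → coeff (compL p) d ≡ pow v d * coeff p d
  compL-leading []      d       _     = sym (QP.*-zeroʳ (pow v d))
  compL-leading (a ∷ p) zero    p<1   = begin
    coeff (compL (a ∷ p)) 0     ≡⟨ compL-cons-zero a p ⟩
    a + u * coeff (compL p) 0   ≡⟨ cong (λ y → a + u * y) (compL-degree p 0 (degree-tail a p 0 p<1) 0 z≤n) ⟩
    a + u * 0ℚ                  ≡⟨ solve 2 (λ a u → a :+ u :* con 0ℚ := con 1ℚ :* a) refl a u ⟩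
    1ℚ * a                      ∎
    where open ≡-Reasoning
  compL-leading (a ∷ p) (suc d) p<d+2 = begin
    coeff (compL (a ∷ p)) (suc d)                          ≡⟨ compL-cons-suc a p d ⟩
    u * coeff (compL p) (suc d) + v * coeff (compL p) d    ≡⟨ cong₂ (λ x y → u * x + v * y)
                                                                (compL-degree p (suc d) tail<d+1 (suc d) NP.≤-refl)
                                                                (compL-leading p d tail<d+1) ⟩
    u * 0ℚ + v * (pow v d * coeff p d)                     ≡⟨ solve 4 (λ u v P c → u :* con 0ℚ :+ v :* (P :* c) := (v :* P) :* c)
                                                                refl u v (pow v d) (coeff p d) ⟩
    (v * pow v d) * coeff p d                              ∎
    where
    open ≡-Reasoning
    tail<d+1 : DegreeBelow p (suc d)
    tail<d+1 = degree-tail a p (suc d) p<d+2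

  compL-second : ∀ p d → DegreeBelow p (suc (suc d)) →
    coeff (compL p) d ≡ pow v d * (coeff p d + ℕtoℚ (suc d) * u * coeff p (suc d))
  compL-second []      d       _     = solve 3 (λ P M u → con 0ℚ := P :* (con 0ℚ :+ M :* u :* con 0ℚ)) refl (pow v d) (ℕtoℚ (suc d)) u
  compL-second (a ∷ p) zero    p<2   = begin
    coeff (compL (a ∷ p)) 0     ≡⟨ compL-cons-zero a p ⟩
    a + u * coeff (compL p) 0   ≡⟨ cong (λ y → a + u * y) (compL-leading p 0 (degree-tail a p 1 p<2)) ⟩
    a + u * (1ℚ * coeff p 0)    ≡⟨ solve 3 (λ a u c → a :+ u :* (con 1ℚ :* c) := con 1ℚ :* (a :+ con (ℕtoℚ 1) :* u :* c))
                                     refl a u (coeff p 0) ⟩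
    1ℚ * (a + ℕtoℚ 1 * u * coeff p 0) ∎
    where open ≡-Reasoning
  compL-second (a ∷ p) (suc d) p<d+3 = begin
    coeff (compL (a ∷ p)) (suc d)                          ≡⟨ compL-cons-suc a p d ⟩
    u * coeff (compL p) (suc d) + v * coeff (compL p) d    ≡⟨ cong₂ (λ x y → u * x + v * y)
                                                                (compL-leading p (suc d) tail<d+2) (compL-second p d tail<d+2) ⟩
    u * (pow v (suc d) * c₂) + v * (pow v d * (c₁ + M * u * c₂))
      ≡⟨ solve 6 (λ u v P c₁ c₂ M → u :* (v :* P :* c₂) :+ v :* (P :* (c₁ :+ M :* u :* c₂))
                                      := v :* P :* (c₁ :+ (con 1ℚ :+ M) :* u :* c₂))
           refl u v (pow v d) c₁ c₂ M ⟩
    pow v (suc d) * (c₁ + (1ℚ + M) * u * c₂)               ≡⟨ cong (λ z → pow v (suc d) * (c₁ + z * u * c₂)) (sym (ℕtoℚ-suc (suc d))) ⟩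
    pow v (suc d) * (c₁ + ℕtoℚ (suc (suc d)) * u * c₂)     ∎
    where
    open ≡-Reasoning
    tail<d+2 : DegreeBelow p (suc (suc d))
    tail<d+2 = degree-tail a p (suc (suc d)) p<d+3
    c₁ : ℚ
    c₁ = coeff p d
    c₂ : ℚ
    c₂ = coeff p (suc d)
    M : ℚ
    M  = ℕtoℚ (suc d)

  compL-third : ∀ p d → DegreeBelow p (suc (suc (suc d))) →
    coeff (compL p) d ≡ pow v d * (coeff p d + ℕtoℚ (suc d) * u * coeff p (suc d)
                                    + ℕtoℚ (suc (suc d) C 2) * u * u * coeff p (suc (suc d)))
  compL-third []      d       _     = solve 4 (λ P M T u → con 0ℚ := P :* (con 0ℚ :+ M :* u :* con 0ℚ :+ T :* u :* u :* con 0ℚ))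
                                        refl (pow v d) (ℕtoℚ (suc d)) (ℕtoℚ (suc (suc d) C 2)) u
  compL-third (a ∷ p) zero    p<3   = begin
    coeff (compL (a ∷ p)) 0     ≡⟨ compL-cons-zero a p ⟩
    a + u * coeff (compL p) 0   ≡⟨ cong (λ y → a + u * y) (compL-second p 0 (degree-tail a p 2 p<3)) ⟩
    a + u * (1ℚ * (coeff p 0 + ℕtoℚ 1 * u * coeff p 1))
      ≡⟨ solve 4 (λ a u c₁ c₂ → a :+ u :* (con 1ℚ :* (c₁ :+ con (ℕtoℚ 1) :* u :* c₂))
                                 := con 1ℚ :* (a :+ con (ℕtoℚ 1) :* u :* c₁ :+ con (ℕtoℚ (2 C 2)) :* u :* u :* c₂))
           refl a u (coeff p 0) (coeff p 1) ⟩
    1ℚ * (a + ℕtoℚ 1 * u * coeff p 0 + ℕtoℚ (2 C 2) * u * u * coeff p 1) ∎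
    where open ≡-Reasoning
  compL-third (a ∷ p) (suc d) p<d+4 = begin
    coeff (compL (a ∷ p)) (suc d)                          ≡⟨ compL-cons-suc a p d ⟩
    u * coeff (compL p) (suc d) + v * coeff (compL p) d    ≡⟨ cong₂ (λ x y → u * x + v * y)
                                                                (compL-second p (suc d) tail<d+3) (compL-third p d tail<d+3) ⟩
    u * (pow v (suc d) * (c₂ + M₂ * u * c₃)) + v * (pow v d * (c₁ + M₁ * u * c₂ + T * u * u * c₃))
      ≡⟨ solve 9 (λ u v P c₁ c₂ c₃ M₁ M₂ T →
                   u :* (v :* P :* (c₂ :+ M₂ :* u :* c₃)) :+ v :* (P :* (c₁ :+ M₁ :* u :* c₂ :+ T :* u :* u :* c₃))
                   := v :* P :* (c₁ :+ (con 1ℚ :+ M₁) :* u :* c₂ :+ (M₂ :+ T) :* u :* u :* c₃))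
           refl u v (pow v d) c₁ c₂ c₃ M₁ M₂ T ⟩
    pow v (suc d) * (c₁ + (1ℚ + M₁) * u * c₂ + (M₂ + T) * u * u * c₃)
      ≡⟨ cong₂ (λ y z → pow v (suc d) * (c₁ + y * u * c₂ + z * u * u * c₃))
           (sym (ℕtoℚ-suc (suc d))) (sym (choose2-suc (suc (suc d)))) ⟩
    pow v (suc d) * (c₁ + ℕtoℚ (suc (suc d)) * u * c₂ + ℕtoℚ (suc (suc (suc d)) C 2) * u * u * c₃) ∎
    where
    open ≡-Reasoning
    tail<d+3 : DegreeBelow p (suc (suc (suc d)))
    tail<d+3 = degree-tail a p (suc (suc (suc d))) p<d+4
    c₁ : ℚ
    c₁ = coeff p d
    c₂ : ℚ
    c₂ = coeff p (suc d)
    c₃ : ℚ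
    c₃ = coeff p (suc (suc d))
    M₁ : ℚ
    M₁ = ℕtoℚ (suc d)
    M₂ : ℚ
    M₂ = ℕtoℚ (suc (suc d))
    T : ℚ
    T  = ℕtoℚ (suc (suc d) C 2)

β γ : ℕ → ℚ
β n = coeff (bernoulliPoly (suc (suc n))) (suc n)
γ n = coeff (bernoulliPoly (suc (suc n))) n

module ShiftedBernoulli (n : ℕ) (u : ℚ) where
  open LinearSubstitution u 1ℚ

  B : Poly
  B = bernoulliPoly (suc (suc n))

  shifted-leading : coeff (compL B) (suc (suc n)) ≡ 1ℚ
  shifted-leading = begin
    coeff (compL B) (suc (suc n))                     ≡⟨ compL-leading B (suc (suc n)) (bernoulli-degree (suc (suc n))) ⟩
    pow 1ℚ (suc (suc n)) * coeff B (suc (suc n))      ≡⟨ cong₂ _*_ (pow-one (suc (suc n))) (bernoulli-leading (suc (suc n))) ⟩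
    1ℚ * 1ℚ                                           ≡⟨⟩
    1ℚ                                                ∎
    where open ≡-Reasoning

  shifted-second : coeff (compL B) (suc n) ≡ β n + ℕtoℚ (suc (suc n)) * u
  shifted-second = begin
    coeff (compL B) (suc n)                                            ≡⟨ compL-second B (suc n) (bernoulli-degree (suc (suc n))) ⟩
    pow 1ℚ (suc n) * (β n + M₂ * u * coeff B (suc (suc n)))            ≡⟨ cong₂ (λ x y → x * (β n + M₂ * u * y))
                                                                            (pow-one (suc n)) (bernoulli-leading (suc (suc n))) ⟩
    1ℚ * (β n + M₂ * u * 1ℚ)                                           ≡⟨ solve 3 (λ b m u → con 1ℚ :* (b :+ m :* u :* con 1ℚ) := b :+ m :* u)
                                                                            refl (β n) M₂ u ⟩
    β n + M₂ * u                                                       ∎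
    where
    open ≡-Reasoning
    M₂ : ℚ
    M₂ = ℕtoℚ (suc (suc n))

  shifted-third : coeff (compL B) n ≡ γ n + ℕtoℚ (suc n) * u * β n + ℕtoℚ (suc (suc n) C 2) * u * u
  shifted-third = begin
    coeff (compL B) n                                                    ≡⟨ compL-third B n (bernoulli-degree (suc (suc n))) ⟩
    pow 1ℚ n * (γ n + M₁ * u * β n + T * u * u * coeff B (suc (suc n)))  ≡⟨ cong₂ (λ x y → x * (γ n + M₁ * u * β n + T * u * u * y))
                                                                              (pow-one n) (bernoulli-leading (suc (suc n))) ⟩
    1ℚ * (γ n + M₁ * u * β n + T * u * u * 1ℚ)                           ≡⟨ solve 5 (λ g m b t u → con 1ℚ :* (g :+ m :* u :* b :+ t :* u :* u :* con 1ℚ)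
                                                                                               := g :+ m :* u :* b :+ t :* u :* u)
                                                                              refl (γ n) M₁ (β n) T u ⟩
    γ n + M₁ * u * β n + T * u * u                                       ∎
    where
    open ≡-Reasoning
    M₁ : ℚ
    M₁ = ℕtoℚ (suc n)
    T : ℚ
    T  = ℕtoℚ (suc (suc n) C 2)

Sfactor : ℤ → ℕ → ℚ
Sfactor a k = (a ℤ.^ k) / 1 * (+ 1 / suc k)

Sfactor-nonzero : ∀ a k → a ≢ 0ℤ → Sfactor a k ≢ 0ℚ
Sfactor-nonzero a k a≢0 = *-nonzero ((a ℤ.^ k) / 1) (+ 1 / suc k) (ℤtoℚ-nonzero (a ℤ.^ k) (λ aᵏ≡0 → a≢0 (ZP.i^n≡0⇒i≡0 a k aᵏ≡0)))
                                        (reciprocal-nonzero k)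

-- B_{k+1}(x + b/a); note that addP X (constP r) is linear (0ℚ + r) 1ℚ
shiftedBernoulli : (a b : ℤ) → a ≢ 0ℤ → ℕ → Poly
shiftedBernoulli a b a≢0 k = compP (bernoulliPoly (suc k)) (linear (0ℚ + divℤ b a a≢0) 1ℚ)

S-coeff-suc : ∀ a b a≢0 k i → coeff (S a b a≢0 k) (suc i) ≡ Sfactor a k * coeff (shiftedBernoulli a b a≢0 k) (suc i)
S-coeff-suc a b a≢0 k i =
  trans (coeff-scaleP (Sfactor a k) (subP P (constP (evalP (bernoulliPoly (suc k)) (divℤ b a a≢0)))) (suc i))
        (cong (Sfactor a k *_) (coeff-addP-constP P _ i))
  where
  P : Poly
  P = shiftedBernoulli a b a≢0 k

S-degree : ∀ a b a≢0 k → DegreeBelow (S a b a≢0 k) (suc (suc k))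
S-degree a b a≢0 k =
  degree-scaleP (Sfactor a k) (subP P (constP ev)) (suc (suc k))
    (degree-addP-constP P (- 1ℚ * ev) (suc k)
      (LinearSubstitution.compL-degree (0ℚ + divℤ b a a≢0) 1ℚ (bernoulliPoly (suc k)) (suc (suc k)) (bernoulli-degree (suc k))))
  where
  P : Poly
  P  = shiftedBernoulli a b a≢0 k
  ev : ℚ
  ev = evalP (bernoulliPoly (suc k)) (divℤ b a a≢0)

module Composite (a b : ℤ) (a≢0 : a ≢ 0ℤ) (u v : ℚ) where
  open LinearSubstitution u v

  r : ℚ
  r = 0ℚ + divℤ b a a≢0

  G : ℕ → Poly
  G n = compL (S a b a≢0 (suc n))

  composite-degree : ∀ n → DegreeBelow (G n) (suc (suc (suc n)))
  composite-degree n = compL-degree (S a b a≢0 (suc n)) (suc (suc (suc n))) (S-degree a b a≢0 (suc n))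

  composite-leading : ∀ n → coeff (G n) (suc (suc n)) ≡ pow v (suc (suc n)) * Sfactor a (suc n)
  composite-leading n = begin
    coeff (G n) (suc (suc n))                                  ≡⟨ compL-leading Sₙ (suc (suc n)) (S-degree a b a≢0 (suc n)) ⟩
    pow v (suc (suc n)) * coeff Sₙ (suc (suc n))               ≡⟨ cong (pow v (suc (suc n)) *_) (S-coeff-suc a b a≢0 (suc n) (suc n)) ⟩
    pow v (suc (suc n)) * (Sfactor a (suc n) * coeff P (suc (suc n)))
      ≡⟨ cong (λ z → pow v (suc (suc n)) * (Sfactor a (suc n) * z)) (ShiftedBernoulli.shifted-leading n r) ⟩
    pow v (suc (suc n)) * (Sfactor a (suc n) * 1ℚ)             ≡⟨ cong (pow v (suc (suc n)) *_) (QP.*-identityʳ (Sfactor a (suc n))) ⟩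
    pow v (suc (suc n)) * Sfactor a (suc n)                    ∎
    where
    open ≡-Reasoning
    Sₙ : Poly
    Sₙ = S a b a≢0 (suc n)
    P : Poly
    P  = shiftedBernoulli a b a≢0 (suc n)

  composite-second : ∀ n → coeff (G n) (suc n) ≡
    pow v (suc n) * (Sfactor a (suc n) * (β n + ℕtoℚ (suc (suc n)) * r + ℕtoℚ (suc (suc n)) * u))
  composite-second n = begin
    coeff (G n) (suc n)                                        ≡⟨ compL-second Sₙ (suc n) (S-degree a b a≢0 (suc n)) ⟩
    pow v (suc n) * (coeff Sₙ (suc n) + M₂ * u * coeff Sₙ (suc (suc n)))
      ≡⟨ cong₂ (λ x y → pow v (suc n) * (x + M₂ * u * y)) (S-coeff-suc a b a≢0 (suc n) n) (S-coeff-suc a b a≢0 (suc n) (suc n)) ⟩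
    pow v (suc n) * (κₛ * coeff P (suc n) + M₂ * u * (κₛ * coeff P (suc (suc n))))
      ≡⟨ cong₂ (λ x y → pow v (suc n) * (κₛ * x + M₂ * u * (κₛ * y))) shifted-second shifted-leading ⟩
    pow v (suc n) * (κₛ * (β n + M₂ * r) + M₂ * u * (κₛ * 1ℚ))
      ≡⟨ cong (pow v (suc n) *_) (solve 5 (λ k b m r u → k :* (b :+ m :* r) :+ m :* u :* (k :* con 1ℚ) := k :* (b :+ m :* r :+ m :* u))
                                          refl κₛ (β n) M₂ r u) ⟩
    pow v (suc n) * (κₛ * (β n + M₂ * r + M₂ * u))             ∎
    where
    open ≡-Reasoning
    open ShiftedBernoulli n r
    Sₙ : Poly
    Sₙ = S a b a≢0 (suc n)
    P : Poly
    P  = shiftedBernoulli a b a≢0 (suc n)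
    κₛ : ℚ
    κₛ = Sfactor a (suc n)
    M₂ : ℚ
    M₂ = ℕtoℚ (suc (suc n))

  -- for k = n + 2 the coefficient of x^{k-1} lies away from the constant term
  composite-third : ∀ n → coeff (G (suc n)) (suc n) ≡
    pow v (suc n) * (Sfactor a (suc (suc n)) *
      (γ (suc n) + ℕtoℚ (suc (suc n)) * r * β (suc n) + ℕtoℚ (suc (suc (suc n)) C 2) * r * r
       + ℕtoℚ (suc (suc n)) * u * (β (suc n) + ℕtoℚ (suc (suc (suc n))) * r) + ℕtoℚ (suc (suc (suc n)) C 2) * u * u))
  composite-third n = begin
    coeff (G (suc n)) (suc n)                                  ≡⟨ compL-third Sₙ (suc n) (S-degree a b a≢0 (suc (suc n))) ⟩
    pow v (suc n) * (coeff Sₙ (suc n) + M₁ * u * coeff Sₙ (suc (suc n)) + T * u * u * coeff Sₙ (suc (suc (suc n))))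
      ≡⟨ cong₂ (λ x y → pow v (suc n) * (x + y)) (cong₂ (λ x y → x + M₁ * u * y) (S-coeff-suc a b a≢0 (suc (suc n)) n)
                                                                            (S-coeff-suc a b a≢0 (suc (suc n)) (suc n)))
                                                  (cong (λ y → T * u * u * y) (S-coeff-suc a b a≢0 (suc (suc n)) (suc (suc n)))) ⟩
    pow v (suc n) * (κₛ * coeff P (suc n) + M₁ * u * (κₛ * coeff P (suc (suc n))) + T * u * u * (κₛ * coeff P (suc (suc (suc n)))))
      ≡⟨ cong₂ (λ x y → pow v (suc n) * (x + y)) (cong₂ (λ x y → κₛ * x + M₁ * u * (κₛ * y)) shifted-third shifted-second)
                                                  (cong (λ y → T * u * u * (κₛ * y)) shifted-leading) ⟩
    pow v (suc n) * (κₛ * (γ (suc n) + M₁ * r * β (suc n) + T * r * r) + M₁ * u * (κₛ * (β (suc n) + M₂ * r)) + T * u * u * (κₛ * 1ℚ))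
      ≡⟨ cong (pow v (suc n) *_) (solve 8 (λ k g m₁ r b t u m₂ →
            k :* (g :+ m₁ :* r :* b :+ t :* r :* r) :+ m₁ :* u :* (k :* (b :+ m₂ :* r)) :+ t :* u :* u :* (k :* con 1ℚ)
            := k :* (g :+ m₁ :* r :* b :+ t :* r :* r :+ m₁ :* u :* (b :+ m₂ :* r) :+ t :* u :* u))
            refl κₛ (γ (suc n)) M₁ r (β (suc n)) T u M₂) ⟩
    pow v (suc n) * (κₛ * (γ (suc n) + M₁ * r * β (suc n) + T * r * r + M₁ * u * (β (suc n) + M₂ * r) + T * u * u)) ∎
    where
    open ≡-Reasoning
    open ShiftedBernoulli (suc n) r
    Sₙ : Poly
    Sₙ = S a b a≢0 (suc (suc n))
    P : Poly
    P  = shiftedBernoulli a b a≢0 (suc (suc n))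
    κₛ : ℚ
    κₛ = Sfactor a (suc (suc n))
    M₁ : ℚ
    M₁ = ℕtoℚ (suc (suc n))
    M₂ : ℚ
    M₂ = ℕtoℚ (suc (suc (suc n)))
    T : ℚ
    T  = ℕtoℚ (suc (suc (suc n)) C 2)

-- Let β₀, γ₀ be the coefficients of x^{m-1}, x^{m-2}
-- in B_m, and M₂ = m, M₁ = m - 1, T = C(m, 2); so 2β₀ = -m and
-- 12γ₀ = m(m-1).  After the substitutions x ↦ x + u₁ and x ↦ x + u₂ these
-- coefficients become E₁ and E₂ below.  E₁ = 0 forces u₁ + u₂ = 1/2, and
-- then 24 E₂ = -m(m-1) ≠ 0.
shifted-subleading-not-both-zero : ∀ β₀ γ₀ T u₁ u₂ M₁ M₂ →
  ℕtoℚ 2 * β₀ + M₂ ≡ 0ℚ → ℕtoℚ 12 * γ₀ ≡ M₂ * M₁ → ℕtoℚ 2 * T ≡ M₂ * M₁ → M₁ ≢ 0ℚ → M₂ ≢ 0ℚ →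
  β₀ + M₂ * u₁ + M₂ * u₂ ≡ 0ℚ →
  γ₀ + M₁ * u₁ * β₀ + T * u₁ * u₁ + M₁ * u₂ * (β₀ + M₂ * u₁) + T * u₂ * u₂ ≡ 0ℚ → ⊥
shifted-subleading-not-both-zero β₀ γ₀ T u₁ u₂ M₁ M₂ 2β₀+M₂≡0 12γ₀≡M₂M₁ 2T≡M₂M₁ M₁≢0 M₂≢0 E₁≡0 E₂≡0 =
  *-nonzero M₁ M₂ M₁≢0 M₂≢0 M₁M₂≡0
  where
  open ≡-Reasoning
  E₁ : ℚ
  E₁ = β₀ + M₂ * u₁ + M₂ * u₂
  E₂ : ℚ
  E₂ = γ₀ + M₁ * u₁ * β₀ + T * u₁ * u₁ + M₁ * u₂ * (β₀ + M₂ * u₁) + T * u₂ * u₂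
  h : ℚ
  h = ℕtoℚ 2 * u₁ + ℕtoℚ 2 * u₂ - 1ℚ

  h≡0 : h ≡ 0ℚ
  h≡0 = cancel-nonzero M₂ h (begin
    M₂ * h                                         ≡⟨ solve 4 (λ b u₁ u₂ m → m :* (con (ℕtoℚ 2) :* u₁ :+ con (ℕtoℚ 2) :* u₂ :- con 1ℚ)
                                                                       := con (ℕtoℚ 2) :* (b :+ m :* u₁ :+ m :* u₂) :- (con (ℕtoℚ 2) :* b :+ m))
                                                          refl β₀ u₁ u₂ M₂ ⟩
    ℕtoℚ 2 * E₁ - (ℕtoℚ 2 * β₀ + M₂)                ≡⟨ cong₂ (λ x y → ℕtoℚ 2 * x - y) E₁≡0 2β₀+M₂≡0 ⟩
    ℕtoℚ 2 * 0ℚ - 0ℚ                               ≡⟨⟩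
    0ℚ                                             ∎) M₂≢0

  -- M₁ M₂ as a combination of quantities that all vanish
  combination : ℚ → ℚ → ℚ → ℚ → ℚ → ℚ
  combination r₁ r₂ r₃ e w = ℕtoℚ 2 * r₂ + ℕtoℚ 12 * r₃ * (u₁ * u₁ + u₂ * u₂) + ℕtoℚ 12 * M₁ * r₁ * (u₁ + u₂)
                             + ℕtoℚ 3 * M₁ * M₂ * w * w - ℕtoℚ 24 * e

  M₁M₂≡0 : M₁ * M₂ ≡ 0ℚ
  M₁M₂≡0 = begin
    M₁ * M₂
      ≡⟨ solve 7 (λ b g t u₁ u₂ m₁ m₂ →
           m₁ :* m₂
           := con (ℕtoℚ 2) :* (con (ℕtoℚ 12) :* g :- m₂ :* m₁)
              :+ con (ℕtoℚ 12) :* (con (ℕtoℚ 2) :* t :- m₂ :* m₁) :* (u₁ :* u₁ :+ u₂ :* u₂)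
              :+ con (ℕtoℚ 12) :* m₁ :* (con (ℕtoℚ 2) :* b :+ m₂) :* (u₁ :+ u₂)
              :+ con (ℕtoℚ 3) :* m₁ :* m₂ :* (con (ℕtoℚ 2) :* u₁ :+ con (ℕtoℚ 2) :* u₂ :- con 1ℚ)
                                           :* (con (ℕtoℚ 2) :* u₁ :+ con (ℕtoℚ 2) :* u₂ :- con 1ℚ)
              :- con (ℕtoℚ 24) :* (g :+ m₁ :* u₁ :* b :+ t :* u₁ :* u₁ :+ m₁ :* u₂ :* (b :+ m₂ :* u₁) :+ t :* u₂ :* u₂))
           refl β₀ γ₀ T u₁ u₂ M₁ M₂ ⟩
    combination (ℕtoℚ 2 * β₀ + M₂) (ℕtoℚ 12 * γ₀ - M₂ * M₁) (ℕtoℚ 2 * T - M₂ * M₁) E₂ h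
      ≡⟨ cong₂ (λ x y → combination x y (ℕtoℚ 2 * T - M₂ * M₁) E₂ h) 2β₀+M₂≡0 (cancel-difference 12γ₀≡M₂M₁) ⟩
    combination 0ℚ 0ℚ (ℕtoℚ 2 * T - M₂ * M₁) E₂ h
      ≡⟨ cong₂ (λ x y → combination 0ℚ 0ℚ x y h) (cancel-difference 2T≡M₂M₁) E₂≡0 ⟩
    combination 0ℚ 0ℚ 0ℚ 0ℚ h
      ≡⟨ cong (combination 0ℚ 0ℚ 0ℚ 0ℚ) h≡0 ⟩
    combination 0ℚ 0ℚ 0ℚ 0ℚ 0ℚ
      ≡⟨ solve 4 (λ u₁ u₂ m₁ m₂ →
           con (ℕtoℚ 2) :* con 0ℚ :+ con (ℕtoℚ 12) :* con 0ℚ :* (u₁ :* u₁ :+ u₂ :* u₂) :+ con (ℕtoℚ 12) :* m₁ :* con 0ℚ :* (u₁ :+ u₂)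
           :+ con (ℕtoℚ 3) :* m₁ :* m₂ :* con 0ℚ :* con 0ℚ :- con (ℕtoℚ 24) :* con 0ℚ := con 0ℚ)
           refl u₁ u₂ M₁ M₂ ⟩
    0ℚ ∎
    where
    cancel-difference : ∀ {x y} → x ≡ y → x - y ≡ 0ℚ
    cancel-difference {x} refl = QP.+-inverseʳ x

subleading-not-both-zero : ∀ a b a≢0 u v n → v ≢ 0ℚ →
  coeff (Composite.G a b a≢0 u v (suc n)) (suc (suc n)) ≡ 0ℚ →
  coeff (Composite.G a b a≢0 u v (suc n)) (suc n) ≡ 0ℚ → ⊥
subleading-not-both-zero a b a≢0 u v n v≢0 G₁≡0 G₂≡0 =
  shifted-subleading-not-both-zero (β (suc n)) (γ (suc n)) (ℕtoℚ (suc (suc (suc n)) C 2)) r u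
    (ℕtoℚ (suc (suc n))) (ℕtoℚ (suc (suc (suc n))))
    (bernoulli-second (suc (suc n))) (bernoulli-third (suc n)) (choose2 (suc (suc n)))
    (ℕtoℚ-suc-nonzero (suc n)) (ℕtoℚ-suc-nonzero (suc (suc n)))
    (cancel-factors (suc (suc n)) (trans (sym (composite-second (suc n))) G₁≡0))
    (cancel-factors (suc n) (trans (sym (composite-third n)) G₂≡0))
  where
  open Composite a b a≢0 u v
  cancel-factors : ∀ i {x} → pow v i * (Sfactor a (suc (suc n)) * x) ≡ 0ℚ → x ≡ 0ℚ
  cancel-factors i {x} eq = cancel-nonzero (Sfactor a (suc (suc n))) x
    (cancel-nonzero (pow v i) (Sfactor a (suc (suc n)) * x) eq (pow-nonzero v i v≢0)) (Sfactor-nonzero a (suc (suc n)) a≢0)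

target-coeff-top : ∀ q e₁ e₀ → 1 ≤ q → coeff (addP (monomial q e₁) (constP e₀)) q ≡ e₁
target-coeff-top (suc q) e₁ e₀ _ = trans (coeff-addP-constP (monomial (suc q) e₁) e₀ q) (coeff-monomial-at (suc q) e₁)

target-coeff-off : ∀ q e₁ e₀ i → suc i ≢ q → coeff (addP (monomial q e₁) (constP e₀)) (suc i) ≡ 0ℚ
target-coeff-off q e₁ e₀ i i+1≢q = trans (coeff-addP-constP (monomial q e₁) e₀ i) (coeff-monomial-off q e₁ (suc i) i+1≢q)

-- q < k + 1: the leading coefficient of the left side survives
lower-degree-impossible : ∀ a b a≢0 u v n q e₁ e₀ → v ≢ 0ℚ → q < suc (suc n) →
  ¬ (compP (S a b a≢0 (suc n)) (linear u v) ≈ₚ addP (monomial q e₁) (constP e₀))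
lower-degree-impossible a b a≢0 u v n q e₁ e₀ v≢0 q<m G≈R =
  *-nonzero (pow v (suc (suc n))) (Sfactor a (suc n)) (pow-nonzero v (suc (suc n)) v≢0) (Sfactor-nonzero a (suc n) a≢0) (begin
    pow v (suc (suc n)) * Sfactor a (suc n)                    ≡⟨ sym (composite-leading n) ⟩
    coeff (G n) (suc (suc n))                                  ≡⟨ G≈R (suc (suc n)) ⟩
    coeff (addP (monomial q e₁) (constP e₀)) (suc (suc n))     ≡⟨ target-coeff-off q e₁ e₀ (suc n) (NP.>⇒≢ q<m) ⟩
    0ℚ                                                         ∎)
  where
  open ≡-Reasoning
  open Composite a b a≢0 u v

-- q > k + 1: the left side has degree below q
higher-degree-impossible : ∀ a b a≢0 u v n q e₁ e₀ → e₁ ≢ 0ℚ → suc (suc n) < q →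
  ¬ (compP (S a b a≢0 (suc n)) (linear u v) ≈ₚ addP (monomial q e₁) (constP e₀))
higher-degree-impossible a b a≢0 u v n q e₁ e₀ e₁≢0 m<q G≈R = e₁≢0 (begin
    e₁                                                         ≡⟨ sym (target-coeff-top q e₁ e₀ (NP.≤-trans (s≤s z≤n) m<q)) ⟩
    coeff (addP (monomial q e₁) (constP e₀)) q                 ≡⟨ sym (G≈R q) ⟩
    coeff (G n) q                                              ≡⟨ composite-degree n q m<q ⟩
    0ℚ                                                         ∎)
  where
  open ≡-Reasoning
  open Composite a b a≢0 u v

-- q = k + 1 ≥ 3: both subleading coefficients of the target vanish
equal-degree-impossible : ∀ a b a≢0 u v n q e₁ e₀ → v ≢ 0ℚ → q ≥ 3 → q ≡ suc (suc n) →
  ¬ (compP (S a b a≢0 (suc n)) (linear u v) ≈ₚ addP (monomial q e₁) (constP e₀))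
equal-degree-impossible a b a≢0 u v zero    _ e₁ e₀ v≢0 (s≤s (s≤s ())) refl
equal-degree-impossible a b a≢0 u v (suc n) _ e₁ e₀ v≢0 _ refl G≈R =
  subleading-not-both-zero a b a≢0 u v n v≢0
    (trans (G≈R (suc (suc n))) (target-coeff-off (suc (suc (suc n))) e₁ e₀ (suc n) (NP.<⇒≢ (NP.n<1+n (suc (suc n))))))
    (trans (G≈R (suc n)) (target-coeff-off (suc (suc (suc n))) e₁ e₀ n (NP.<⇒≢ (NP.m<n⇒m<1+n (NP.n<1+n (suc n))))))

-- the substituted polynomial c₁ x + c₀ is, by definition, linear (c₁ * 0ℚ + c₀) (c₁ * 1ℚ)
slope-nonzero : ∀ c → c ≢ 0ℚ → c * 1ℚ ≢ 0ℚ
slope-nonzero c c≢0 c*1≡0 = c≢0 (trans (sym (QP.*-identityʳ c)) c*1≡0)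

lemma3 : (a b : ℤ) (a≢0 : a ≢ 0ℤ) → gcd a b ≡ + 1 →
    (k : ℕ) → k ≥ 1 →
    (c₁ c₀ e₁ e₀ : ℚ) → c₁ ≢ 0ℚ → e₁ ≢ 0ℚ →
    (q : ℕ) → q ≥ 3 →
    ¬ (compP (S a b a≢0 k) (addP (scaleP c₁ X) (constP c₀))
    ≈ₚ addP (monomial q e₁) (constP e₀))
lemma3 a b a≢0 _ zero    ()
lemma3 a b a≢0 _ (suc n) _ c₁ c₀ e₁ e₀ c₁≢0 e₁≢0 q q≥3 with NP.<-cmp q (suc (suc n))
... | tri< q<m _ _ = lower-degree-impossible  a b a≢0 (c₁ * 0ℚ + c₀) (c₁ * 1ℚ) n q e₁ e₀ (slope-nonzero c₁ c₁≢0) q<m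
... | tri≈ _ q≡m _ = equal-degree-impossible  a b a≢0 (c₁ * 0ℚ + c₀) (c₁ * 1ℚ) n q e₁ e₀ (slope-nonzero c₁ c₁≢0) q≥3 q≡m
... | tri> _ _ m<q = higher-degree-impossible a b a≢0 (c₁ * 0ℚ + c₀) (c₁ * 1ℚ) n q e₁ e₀ e₁≢0 m<q
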